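{- Let $\Sigma$ be a finite totally ordered alphabet and let $\prec$ denote $V$-order on $\Sigma^*$. Let $\mathbf{x},\mathbf{y}$ be nonempty strings with $V$-forms $$\mathbf{x}=\mathbf{x}_0\,\mathcal{L}_{\mathbf{x}}\,\mathbf{x}_1\,\mathcal{L}_{\mathbf{x}}\cdots\mathbf{x}_{j-1}\,\mathcal{L}_{\mathbf{x}}\,\mathbf{x}_j,\qquad \mathbf{y}=\mathbf{y}_0\,\mathcal{L}_{\mathbf{y}}\,\mathbf{y}_1\,\mathcal{L}_{\mathbf{y}}\cdots\mathbf{y}_{k-1}\,\mathcal{L}_{\mathbf{y}}\,\mathbf{y}_k,$$ where $j=\mathcal{C}_{\mathbf{x}}$, $k=\mathcal{C}_{\mathbf{y}}$. Let $\lambda\in\Sigma$ be a letter with $\lambda\le\max(\mathcal{L}_{\mathbf{x}},\mathcal{L}_{\mathbf{y}})$ and let $i$ be an integer with $0\le i\le\min(j,k)$. Let $\mathbf{x}'$ (resp. $\mathbf{y}'$) be the string obtained from $\mathbf{x}$ (resp. $\mathbf{y}$) by inserting $\lambda$ immediately after the block $\mathbf{x}_i$ (resp. $\mathbf{y}_i$) of its $V$-form, i.e. $\mathbf{x}'=\mathbf{x}_0\mathcal{L}_{\mathbf{x}}\cdots\mathcal{L}_{\mathbf{x}}\mathbf{x}_i\lambda\mathcal{L}_{\mathbf{x}}\cdots\mathcal{L}_{\mathbf{x}}\mathbf{x}_j$, and let $\mathbf{x}''$ (resp. $\mathbf{y}''$) be obtained by inserting $\lambda$ immediately before the block $\mathbf{x}_i$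 (resp. $\mathbf{y}_i$), i.e. $\mathbf{x}''=\mathbf{x}_0\mathcal{L}_{\mathbf{x}}\cdots\mathcal{L}_{\mathbf{x}}\lambda\mathbf{x}_i\mathcal{L}_{\mathbf{x}}\cdots\mathcal{L}_{\mathbf{x}}\mathbf{x}_j$ (and analogously for $\mathbf{y}'$, $\mathbf{y}''$). Then $$\mathbf{x}'\prec\mathbf{y}'\iff\mathbf{x}\prec\mathbf{y}\iff\mathbf{x}''\prec\mathbf{y}''.$$
   Context: $\Sigma^*$ denotes the set of all finite strings over $\Sigma$, including the empty string $\varepsilon$. For a nonempty string $\mathbf{x}=x_1x_2\cdots x_n$, define $h\in\{1,\ldots,n\}$ by $h=1$ if $x_1\le x_2\le\cdots\le x_n$, and otherwise as the unique index with $x_{h-1}>x_h\le x_{h+1}\le\cdots\le x_n$; let $\mathbf{x}^*$ be the string obtained from $\mathbf{x}$ by deleting the letter $x_h$. Write $\mathbf{x}^{s*}$ for the result of applying $^*$ $s$ times ($\mathbf{x}^{0*}=\mathbf{x}$); the sequence $\mathbf{x},\mathbf{x}^*,\mathbf{x}^{2*},\ldots$ ends with $\varepsilon$. $V$-order $\prec$ is defined for distinct strings $\mathbf{x},\mathbf{y}$ as follows: $\mathbf{x}\prec\mathbf{y}$ if $\mathbf{x}$ occurs in the sequence $\mathbf{y},\mathbf{y}^*,\mathbf{y}^{2*},\ldots,\varepsilon$. If neither string occurs in the other's sequence, there are smallest $s,t\ge 0$ with $\mathbf{x}^{(s+1)*}=\mathbf{y}^{(t+1)*}$; put $\mathbf{s}=\mathbf{x}^{s*}$,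 $\mathbf{t}=\mathbf{y}^{t*}$, which are distinct strings of equal length $m$; let $j\in\{1,\ldots,m\}$ be the largest index with $\mathbf{s}[j]\ne\mathbf{t}[j]$; then $\mathbf{x}\prec\mathbf{y}$ iff $\mathbf{s}[j]<\mathbf{t}[j]$ in $\Sigma$. This is a strict total order on $\Sigma^*$. $V$-form: for a nonempty string $\mathbf{x}$, $\mathcal{L}_{\mathbf{x}}$ denotes the largest letter occurring in $\mathbf{x}$ and $\mathcal{C}_{\mathbf{x}}$ the number of its occurrences; writing $k=\mathcal{C}_{\mathbf{x}}$, the $V$-form of $\mathbf{x}$ is the unique decomposition $\mathbf{x}=\mathbf{x}_0\mathcal{L}_{\mathbf{x}}\mathbf{x}_1\mathcal{L}_{\mathbf{x}}\cdots\mathbf{x}_{k-1}\mathcal{L}_{\mathbf{x}}\mathbf{x}_k$, where the (possibly empty) strings $\mathbf{x}_0,\ldots,\mathbf{x}_k$ do not contain $\mathcal{L}_{\mathbf{x}}$. -}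

module Defs where

open import Data.Nat using (ℕ; zero; suc)
open import Data.Fin using (Fin; _≤?_; _<_; _≟_)
open import Data.List using (List; []; _∷_; _++_; [_]; length)
open import Data.Bool using (Bool; true; false; if_then_else_; _∧_)
open import Data.Product using (Σ; ∃; _×_; _,_)
open import Data.Sum using (_⊎_)
open import Relation.Nullary using (¬_; does)
open import Relation.Binary.PropositionalEquality using (_≡_; _≢_)

-- The alphabet: a finite totally ordered set, represented as Fin σ
-- with its standard order (every finite total order is isomorphic to one).
Str : ℕ → Set
Str σ = List (Fin σ)

module _ {σ : ℕ} where

  nondec : Str σ → Bool
  nondec [] = true
  nondec (a ∷ []) = true
  nondec (a ∷ b ∷ xs) = does (a ≤? b) ∧ nondec (b ∷ xs)

  -- x* : delete the letter x_h, where h is the start of the maximal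
  -- nondecreasing suffix (h = 1 if x is nondecreasing).
  -- ε* = ε (irrelevant: the sequence ends at ε).
  star : Str σ → Str σ
  star [] = []
  star (a ∷ xs) = if nondec (a ∷ xs) then xs else a ∷ star xs

  iter : ℕ → Str σ → Str σ
  iter zero x = x
  iter (suc s) x = star (iter s x)

  Occurs : Str σ → Str σ → Set
  Occurs x y = ∃ λ s → iter s y ≡ x

  -- s and t (of equal length) differ, and at the largest index j with
  -- s[j] ≠ t[j] we have s[j] < t[j]: s = u a w, t = v b w, a < b
  -- (w the common suffix after position j).
  LastDiffLess : Str σ → Str σ → Set
  LastDiffLess s t =
    Σ (Str σ) λ u → Σ (Str σ) λ v → Σ (Str σ) λ w → Σ (Fin σ) λ a → Σ (Fin σ) λ b →
      (s ≡ u ++ [ a ] ++ w) × (t ≡ v ++ [ b ] ++ w) × (length u ≡ length v) × a < b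

  MinMeet : Str σ → Str σ → ℕ → ℕ → Set
  MinMeet x y s t =
    (iter (suc s) x ≡ iter (suc t) y) ×
    (∀ s' t' → iter (suc s') x ≡ iter (suc t') y → (s Data.Nat.≤ s') × (t Data.Nat.≤ t'))

  _≺_ : Str σ → Str σ → Set
  x ≺ y = (x ≢ y) ×
    (Occurs x y ⊎
     (¬ Occurs x y × ¬ Occurs y x ×
      Σ ℕ λ s → Σ ℕ λ t → MinMeet x y s t × LastDiffLess (iter s x) (iter t y)))

  maxLetter : Fin σ → Fin σ → Fin σ
  maxLetter a b = if does (a ≤? b) then b else a

  𝓛 : Fin σ → Str σ → Fin σ
  𝓛 a [] = a
  𝓛 a (b ∷ bs) = maxLetter a (𝓛 b bs)

  count : Fin σ → Str σ → ℕ
  count L [] = zero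
  count L (c ∷ xs) = if does (c ≟ L) then suc (count L xs) else count L xs

  𝓒 : Fin σ → Str σ → ℕ
  𝓒 a as = count (𝓛 a as) (a ∷ as)

  -- With V-form x = x₀ L x₁ L ⋯ L x_k (L the letter, blocks L-free):
  -- insAfter L i λ x inserts λ immediately after block x_i,
  -- insBefore L i λ x inserts λ immediately before block x_i  (0 ≤ i ≤ k).
  insAfter : Fin σ → ℕ → Fin σ → Str σ → Str σ
  insAfter L zero l [] = l ∷ []
  insAfter L zero l (c ∷ xs) =
    if does (c ≟ L) then l ∷ c ∷ xs else c ∷ insAfter L zero l xs
  insAfter L (suc i) l [] = []
  insAfter L (suc i) l (c ∷ xs) =
    c ∷ (if does (c ≟ L) then insAfter L i l xs else insAfter L (suc i) l xs)

  insBefore : Fin σ → ℕ → Fin σ → Str σ → Str σ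
  insBefore L zero l xs = l ∷ xs
  insBefore L (suc i) l [] = []
  insBefore L (suc i) l (c ∷ xs) =
    c ∷ (if does (c ≟ L) then insBefore L i l xs else insBefore L (suc i) l xs)

-- Write x⁽ᵈ⁾ for the member of length d of the sequence x, x*, x**, …, ε. Then x ≺ y iff x is a
-- proper member of the sequence of y, or the two sequences agree at some length d and their members
-- of length d + 1 satisfy the last-difference condition; in this form ≺ is visibly a strict total order.
-- Split x = w L z at the last occurrence of its largest letter L. Starring deletes letters of z until
-- z is exhausted and only then letters of w, always keeping L last; hence
--   w L z ≺ w′ L′ z′  iff  L < L′,  or  L = L′ and w ≺ w′,  or  L = L′, w = w′ and z ≺ z′.
-- So more occurrences of the common largest letter make a string larger, and appending or prepending
-- a fixed letter preserves ≺. Inserting λ after (before) block i changes the numbers of occurrences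
-- of the largest letter in x and y alike; when these are equal, the insertion happens inside w, where
-- induction applies, or it appends λ (prepends λ, or puts it right after the last L), which preserves
-- ≺ as above. Since ≺ is total, preservation yields the equivalences.

module Submission where

open import Defs
open import Data.Nat using (ℕ; _≤_)
open import Data.Fin using (Fin) renaming (_≤_ to _≤ᶠ_)
open import Data.List using (List; _∷_)
open import Data.Product using (_×_)
open import Function.Bundles using (_⇔_)

open import Data.Bool using (true; false; if_then_else_; _∧_)
open import Data.Bool.Properties using (∧-zeroʳ)
open import Data.Empty using (⊥-elim)
open import Data.Fin using (_≟_) renaming (_<_ to _<ᶠ_; _≤?_ to _≤ᶠ?_)
import Data.Fin.Properties as Fin
open import Data.List using ([]; _++_; [_]; length; reverse)
open import Data.List.Membership.Propositional using (_∈_)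
open import Data.List.Properties
  using (length-++; ++-assoc; reverse-++; unfold-reverse; reverse-involutive; length-reverse;
         reverse-injective; ≡-dec)
open import Data.List.Relation.Binary.Lex.Strict
  using (Lex-<; this; next; <-irreflexive; <-asymmetric; <-compare)
open import Data.List.Relation.Binary.Pointwise using (Pointwise-≡⇒≡; ≡⇒Pointwise-≡)
open import Data.List.Relation.Unary.All as All using (All; []; _∷_)
open import Data.List.Relation.Unary.All.Properties using (++⁺; ++⁻ˡ; ++⁻ʳ; ∷ʳ⁺)
open import Data.List.Relation.Unary.Any using (here; there)
open import Data.Nat using (zero; suc; pred; _+_; _∸_; _<_; z≤n; s≤s)
open import Data.Nat.Induction using (<-wellFounded)
import Data.Nat.Properties as ℕ
open import Data.Product using (Σ; _,_; proj₁; proj₂)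
open import Data.Sum using (_⊎_; inj₁; inj₂; swap)
open import Function using (_∘_; flip)
open import Function.Bundles using (mk⇔)
open import Function.Construct.Composition using (_⇔-∘_)
open import Function.Construct.Symmetry using (⇔-sym)
open import Induction.WellFounded using (Acc; acc)
open import Relation.Binary.Consequences using (tri⇒irr; tri⇒asym)
open import Relation.Binary.Core using (Rel)
open import Relation.Binary.Definitions using (Trichotomous; tri<; tri≈; tri>)
open import Relation.Binary.PropositionalEquality hiding ([_])
open import Relation.Nullary using (¬_; yes; no; does)
open import Relation.Nullary.Decidable using (dec-true; dec-false)

preserves⇒reflects : ∀ {a ℓ} {A : Set a} {_<_ : Rel A ℓ} → Trichotomous _≡_ _<_ → ∀ {x y x′ y′} →
                     (x ≡ y → x′ ≡ y′) → (y < x → y′ < x′) → x′ < y′ → x < y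
preserves⇒reflects compare {x} {y} x≡y⇒ y<x⇒ x′<y′ with compare x y
... | tri< x<y _ _ = x<y
... | tri≈ _ x≡y _ = ⊥-elim (tri⇒irr compare (x≡y⇒ x≡y) x′<y′)
... | tri> _ _ y<x = ⊥-elim (tri⇒asym compare x′<y′ (y<x⇒ y<x))

module _ {σ : ℕ} where

  private variable
    a b l L L′ M : Fin σ
    u v w x y z w′ z′ x′ : Str σ
    i : ℕ

  star-nondec : ∀ a (x : Str σ) → nondec (a ∷ x) ≡ true → star (a ∷ x) ≡ x
  star-nondec a x eq = cong (λ b → if b then x else a ∷ star x) eq

  star-¬nondec : ∀ a (x : Str σ) → nondec (a ∷ x) ≡ false → star (a ∷ x) ≡ a ∷ star x
  star-¬nondec a x eq = cong (λ b → if b then x else a ∷ star x) eq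

  data StarStep (a : Fin σ) (x : Str σ) : Set where
    drop-head : nondec (a ∷ x) ≡ true → star (a ∷ x) ≡ x → StarStep a x
    keep-head : nondec (a ∷ x) ≡ false → star (a ∷ x) ≡ a ∷ star x → StarStep a x

  starStep : ∀ a (x : Str σ) → StarStep a x
  starStep a x with nondec (a ∷ x) in eq
  ... | true = drop-head eq (star-nondec a x eq)
  ... | false = keep-head eq (star-¬nondec a x eq)

  length-star : ∀ (x : Str σ) → length (star x) ≡ pred (length x)
  length-star [] = refl
  length-star (a ∷ []) = refl
  length-star (a ∷ x@(_ ∷ _)) with starStep a x | length-star x
  ... | drop-head _ eq | _  = cong length eq
  ... | keep-head _ eq | ih = trans (cong length eq) (cong suc ih)

  length-iter : ∀ s (x : Str σ) → length (iter s x) ≡ length x ∸ s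
  length-iter zero x = refl
  length-iter (suc s) x = begin
    length (star (iter s x)) ≡⟨ length-star (iter s x) ⟩
    pred (length (iter s x)) ≡⟨ cong pred (length-iter s x) ⟩
    pred (length x ∸ s)      ≡⟨ ℕ.pred[m∸n]≡m∸[1+n] (length x) s ⟩
    length x ∸ suc s         ∎
    where open ≡-Reasoning

  length-iter-≤ : ∀ s (x : Str σ) → length (iter s x) ≤ length x
  length-iter-≤ s x = subst (_≤ length x) (sym (length-iter s x)) (ℕ.m∸n≤m (length x) s)

  iter-nonempty : ∀ s (x : Str σ) → s < length x → iter s x ≢ []
  iter-nonempty s x s<x eq = ℕ.<-irrefl (trans (sym (cong length eq)) (length-iter s x)) (ℕ.m<n⇒0<n∸m s<x)

  iter-+ : ∀ s t (x : Str σ) → iter (s + t) x ≡ iter s (iter t x)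
  iter-+ zero t x = refl
  iter-+ (suc s) t x = cong star (iter-+ s t x)

  iter-≥length : ∀ s (x : Str σ) → length x ≤ s → iter s x ≡ []
  iter-≥length s x le with iter s x | length-iter s x
  ... | [] | _ = refl
  ... | _ ∷ _ | eq = ⊥-elim (ℕ.0≢1+n (trans (sym (ℕ.m≤n⇒m∸n≡0 le)) (sym eq)))

  All-star : ∀ {P : Fin σ → Set} (x : Str σ) → All P x → All P (star x)
  All-star [] [] = []
  All-star (a ∷ x) (pa ∷ px) with starStep a x
  ... | drop-head _ eq = subst (All _) (sym eq) px
  ... | keep-head _ eq = subst (All _) (sym eq) (pa ∷ All-star x px)

  All-iter : ∀ {P : Fin σ → Set} s (x : Str σ) → All P x → All P (iter s x)
  All-iter zero x px = px
  All-iter (suc s) x px = All-star (iter s x) (All-iter s x px)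

  -- The member of length d of the sequence x, x*, x**, …, ε (when d ≤ length x).
  ancestor : ℕ → Str σ → Str σ
  ancestor d x = iter (length x ∸ d) x

  length-ancestor : ∀ d (x : Str σ) → d ≤ length x → length (ancestor d x) ≡ d
  length-ancestor d x le = trans (length-iter (length x ∸ d) x) (ℕ.m∸[m∸n]≡n le)

  ancestor-length : ∀ (x : Str σ) → ancestor (length x) x ≡ x
  ancestor-length x rewrite ℕ.n∸n≡0 (length x) = refl

  ancestor-0 : ∀ (x : Str σ) → ancestor 0 x ≡ []
  ancestor-0 x = iter-≥length (length x) x ℕ.≤-refl

  ancestor-iter : ∀ s (x : Str σ) → ancestor (length x ∸ s) x ≡ iter s x
  ancestor-iter s x with ℕ.≤-total s (length x)
  ... | inj₁ le rewrite ℕ.m∸[m∸n]≡n le = refl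
  ... | inj₂ ge rewrite ℕ.m≤n⇒m∸n≡0 ge = trans (ancestor-0 x) (sym (iter-≥length s x ge))

  ancestor-ancestor : ∀ e d (x : Str σ) → e ≤ d → d ≤ length x → ancestor e (ancestor d x) ≡ ancestor e x
  ancestor-ancestor e d x e≤d d≤x = begin
    iter (length (ancestor d x) ∸ e) (ancestor d x)
      ≡⟨ cong (λ k → iter (k ∸ e) (ancestor d x)) (length-ancestor d x d≤x) ⟩
    iter (d ∸ e) (iter (length x ∸ d) x)
      ≡⟨ iter-+ (d ∸ e) (length x ∸ d) x ⟨
    iter ((d ∸ e) + (length x ∸ d)) x
      ≡⟨ cong (λ k → iter k x) (∸-+-∸ e≤d d≤x) ⟩
    iter (length x ∸ e) x ∎
    where
      open ≡-Reasoning
      ∸-+-∸ : ∀ {e d n} → e ≤ d → d ≤ n → (d ∸ e) + (n ∸ d) ≡ n ∸ e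
      ∸-+-∸ {d = d} z≤n d≤n = ℕ.m+[n∸m]≡n d≤n
      ∸-+-∸ (s≤s e≤d) (s≤s d≤n) = ∸-+-∸ e≤d d≤n

  ancestors-agree : ∀ e d (x y : Str σ) → e ≤ d → d ≤ length x → d ≤ length y →
                    ancestor d x ≡ ancestor d y → ancestor e x ≡ ancestor e y
  ancestors-agree e d x y e≤d d≤x d≤y eq = begin
    ancestor e x                ≡⟨ ancestor-ancestor e d x e≤d d≤x ⟨
    ancestor e (ancestor d x)   ≡⟨ cong (ancestor e) eq ⟩
    ancestor e (ancestor d y)   ≡⟨ ancestor-ancestor e d y e≤d d≤y ⟩
    ancestor e y                ∎
    where open ≡-Reasoning

  iter-ancestor : ∀ s (x : Str σ) {n} → length (iter s x) ≡ n → iter s x ≡ ancestor n x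
  iter-ancestor s x refl = trans (sym (ancestor-iter s x)) (cong (λ k → ancestor k x) (sym (length-iter s x)))

  reverse-++-∷ : ∀ (u : Str σ) a w → reverse (u ++ a ∷ w) ≡ reverse w ++ a ∷ reverse u
  reverse-++-∷ u a w = begin
    reverse (u ++ a ∷ w)            ≡⟨ reverse-++ u (a ∷ w) ⟩
    reverse (a ∷ w) ++ reverse u    ≡⟨ cong (_++ reverse u) (unfold-reverse a w) ⟩
    (reverse w ++ [ a ]) ++ reverse u ≡⟨ ++-assoc (reverse w) [ a ] (reverse u) ⟩
    reverse w ++ a ∷ reverse u      ∎
    where open ≡-Reasoning

  LastDiffLess-++ʳ : ∀ r → LastDiffLess u v → LastDiffLess (u ++ r) (v ++ r)
  LastDiffLess-++ʳ r (p , q , w , a , b , refl , refl , |p|≡|q| , a<b) =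
    p , q , w ++ r , a , b , ++-assoc p (a ∷ w) r , ++-assoc q (b ∷ w) r , |p|≡|q| , a<b

  LastDiffLess-++ˡ : ∀ r → LastDiffLess u v → LastDiffLess (r ++ u) (r ++ v)
  LastDiffLess-++ˡ r (p , q , w , a , b , refl , refl , |p|≡|q| , a<b) =
    r ++ p , r ++ q , w , a , b , sym (++-assoc r p (a ∷ w)) , sym (++-assoc r q (b ∷ w)) ,
    trans (length-++ r) (trans (cong (length r +_) |p|≡|q|) (sym (length-++ r))) , a<b

  LastDiffLess⇒length : LastDiffLess u v → Σ ℕ λ d → length u ≡ suc d × length v ≡ suc d
  LastDiffLess⇒length (p , q , w , a , b , refl , refl , |p|≡|q| , _) =
    length p + length w ,
    trans (length-++ p) (ℕ.+-suc (length p) (length w)) ,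
    trans (length-++ q) (trans (ℕ.+-suc (length q) (length w)) (cong (λ k → suc (k + length w)) (sym |p|≡|q|)))

  -- LastDiffLess is the lexicographic order on reversed strings of equal length.
  LastDiffLess⇒Lex : LastDiffLess u v → Lex-< _≡_ _<ᶠ_ (reverse u) (reverse v)
  LastDiffLess⇒Lex (p , q , w , a , b , refl , refl , _ , a<b)
    rewrite reverse-++-∷ p a w | reverse-++-∷ q b w = Lex-<-++ (reverse w)
    where
      Lex-<-++ : ∀ r → Lex-< _≡_ _<ᶠ_ (r ++ a ∷ reverse p) (r ++ b ∷ reverse q)
      Lex-<-++ [] = this a<b
      Lex-<-++ (c ∷ r) = next refl (Lex-<-++ r)

  Lex⇒LastDiffLess : Lex-< _≡_ _<ᶠ_ u v → length u ≡ length v → LastDiffLess (reverse u) (reverse v)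
  Lex⇒LastDiffLess {a ∷ u} {b ∷ v} (this a<b) eq =
    reverse u , reverse v , [] , a , b , unfold-reverse a u , unfold-reverse b v ,
    trans (length-reverse u) (trans (ℕ.suc-injective eq) (sym (length-reverse v))) , a<b
  Lex⇒LastDiffLess {c ∷ u} {c ∷ v} (next refl u<v) eq =
    subst₂ LastDiffLess (sym (unfold-reverse c u)) (sym (unfold-reverse c v))
      (LastDiffLess-++ʳ [ c ] (Lex⇒LastDiffLess u<v (ℕ.suc-injective eq)))

  Lex-reverse⇒LastDiffLess : Lex-< _≡_ _<ᶠ_ (reverse u) (reverse v) → length u ≡ length v → LastDiffLess u v
  Lex-reverse⇒LastDiffLess {u} {v} u<v eq =
    subst₂ LastDiffLess (reverse-involutive u) (reverse-involutive v)
      (Lex⇒LastDiffLess u<v (trans (length-reverse u) (trans eq (sym (length-reverse v)))))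

  LastDiffLess-irrefl : ¬ LastDiffLess u u
  LastDiffLess-irrefl u<u = <-irreflexive Fin.<-irrefl (≡⇒Pointwise-≡ refl) (LastDiffLess⇒Lex u<u)

  LastDiffLess-asym : LastDiffLess u v → ¬ LastDiffLess v u
  LastDiffLess-asym u<v v<u =
    <-asymmetric sym (resp₂ _<ᶠ_) Fin.<-asym (LastDiffLess⇒Lex u<v) (LastDiffLess⇒Lex v<u)

  LastDiffLess-total : length u ≡ length v → u ≢ v → LastDiffLess u v ⊎ LastDiffLess v u
  LastDiffLess-total {u} {v} eq u≢v with <-compare sym Fin.<-cmp (reverse u) (reverse v)
  ... | tri< u<v _ _ = inj₁ (Lex-reverse⇒LastDiffLess u<v eq)
  ... | tri≈ _ u≈v _ = ⊥-elim (u≢v (reverse-injective (Pointwise-≡⇒≡ u≈v)))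
  ... | tri> _ _ v<u = inj₂ (Lex-reverse⇒LastDiffLess v<u (sym eq))

  -- V-order through the star sequence

  infix 4 _⊏_ _<ᵛ_

  _⊏_ : Str σ → Str σ → Set
  x ⊏ y = length x < length y × ancestor (length x) y ≡ x

  BranchLess : Str σ → Str σ → Set
  BranchLess x y = Σ ℕ λ d → d < length x × d < length y ×
    ancestor d x ≡ ancestor d y × LastDiffLess (ancestor (suc d) x) (ancestor (suc d) y)

  _<ᵛ_ : Str σ → Str σ → Set
  x <ᵛ y = x ⊏ y ⊎ BranchLess x y

  Occurs⇒ancestor : Occurs x y → ancestor (length x) y ≡ x
  Occurs⇒ancestor (s , refl) = sym (iter-ancestor s _ refl)

  Occurs⇒length≤ : Occurs x y → length x ≤ length y
  Occurs⇒length≤ (s , refl) = length-iter-≤ s _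

  Occurs⇒ancestors-agree : Occurs x y → ∀ e → e ≤ length x → ancestor e x ≡ ancestor e y
  Occurs⇒ancestors-agree {x} {y} x∈y e e≤x =
    ancestors-agree e (length x) x y e≤x ℕ.≤-refl (Occurs⇒length≤ x∈y)
      (trans (ancestor-length x) (sym (Occurs⇒ancestor x∈y)))

  Occurs⇒¬BranchLess : Occurs x y → ¬ BranchLess x y
  Occurs⇒¬BranchLess x∈y (d , d<x , _ , _ , x<y) =
    LastDiffLess-irrefl (subst (LastDiffLess _) (sym (Occurs⇒ancestors-agree x∈y (suc d) d<x)) x<y)

  Occurs⇒¬BranchLess⁻¹ : Occurs x y → ¬ BranchLess y x
  Occurs⇒¬BranchLess⁻¹ x∈y (d , _ , d<x , _ , y<x) =
    LastDiffLess-irrefl (subst (LastDiffLess _) (Occurs⇒ancestors-agree x∈y (suc d) d<x) y<x)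

  ⊏⇒Occurs : x ⊏ y → Occurs x y
  ⊏⇒Occurs {x} {y} (_ , eq) = length y ∸ length x , eq

  BranchLess⇒common-length≤ : ((d , _) : BranchLess x y) → ∀ m → m ≤ length x → m ≤ length y →
                              ancestor m x ≡ ancestor m y → m ≤ d
  BranchLess⇒common-length≤ {x} {y} (d , _ , _ , _ , x<y) m m≤x m≤y eq with suc d ℕ.≤? m
  ... | no d≮m = ℕ.≤-pred (ℕ.≰⇒> d≮m)
  ... | yes d<m = ⊥-elim (LastDiffLess-irrefl
                    (subst (LastDiffLess _) (sym (ancestors-agree (suc d) m x y d<m m≤x m≤y eq)) x<y))

  BranchLess-asym : BranchLess x y → ¬ BranchLess y x
  BranchLess-asym {x} {y} (d , d<x , d<y , eq , x<y) (d′ , d′<y , d′<x , eq′ , y<x) with ℕ.<-cmp d d′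
  ... | tri< d<d′ _ _ = LastDiffLess-irrefl
          (subst (λ s → LastDiffLess s _)
            (sym (ancestors-agree (suc d) d′ y x d<d′ (ℕ.<⇒≤ d′<y) (ℕ.<⇒≤ d′<x) eq′)) x<y)
  ... | tri≈ _ refl _ = LastDiffLess-asym x<y y<x
  ... | tri> _ _ d′<d = LastDiffLess-irrefl
          (subst (λ s → LastDiffLess s _)
            (sym (ancestors-agree (suc d′) d x y d′<d (ℕ.<⇒≤ d<x) (ℕ.<⇒≤ d<y) eq)) y<x)

  <ᵛ-irrefl : ¬ x <ᵛ x
  <ᵛ-irrefl (inj₁ (x<x , _)) = ℕ.<-irrefl refl x<x
  <ᵛ-irrefl (inj₂ (_ , _ , _ , _ , x<x)) = LastDiffLess-irrefl x<x

  <ᵛ-asym : x <ᵛ y → ¬ y <ᵛ x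
  <ᵛ-asym (inj₁ (x<y , _)) (inj₁ (y<x , _)) = ℕ.<-asym x<y y<x
  <ᵛ-asym (inj₁ x⊏y) (inj₂ y<x) = Occurs⇒¬BranchLess⁻¹ (⊏⇒Occurs x⊏y) y<x
  <ᵛ-asym (inj₂ x<y) (inj₁ y⊏x) = Occurs⇒¬BranchLess⁻¹ (⊏⇒Occurs y⊏x) x<y
  <ᵛ-asym (inj₂ x<y) (inj₂ y<x) = BranchLess-asym x<y y<x

  first-divergence : ∀ k (x y : Str σ) → k ≤ length x → k ≤ length y → ancestor k x ≡ ancestor k y ⊎
    Σ ℕ λ d → d < k × ancestor d x ≡ ancestor d y × ancestor (suc d) x ≢ ancestor (suc d) y
  first-divergence zero x y _ _ = inj₁ (trans (ancestor-0 x) (sym (ancestor-0 y)))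
  first-divergence (suc k) x y k<x k<y with first-divergence k x y (ℕ.<⇒≤ k<x) (ℕ.<⇒≤ k<y)
  ... | inj₂ (d , d<k , eq , neq) = inj₂ (d , ℕ.m≤n⇒m≤1+n d<k , eq , neq)
  ... | inj₁ eq with ≡-dec _≟_ (ancestor (suc k) x) (ancestor (suc k) y)
  ...   | yes eq′ = inj₁ eq′
  ...   | no neq = inj₂ (k , ℕ.≤-refl , eq , neq)

  <ᵛ-total-≤ : length x ≤ length y → x ≢ y → x <ᵛ y ⊎ y <ᵛ x
  <ᵛ-total-≤ {x} {y} x≤y x≢y with first-divergence (length x) x y ℕ.≤-refl x≤y
  ... | inj₁ eq = inj₁ (inj₁ (ℕ.≤∧≢⇒< x≤y |x|≢|y| , trans (sym eq) (ancestor-length x)))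
    where
      |x|≢|y| : length x ≢ length y
      |x|≢|y| |x|≡|y| = x≢y (trans (sym (ancestor-length x))
                              (trans eq (trans (cong (λ k → ancestor k y) |x|≡|y|) (ancestor-length y))))
  ... | inj₂ (d , d<x , eq , neq)
    with LastDiffLess-total
           (trans (length-ancestor (suc d) x d<x) (sym (length-ancestor (suc d) y (ℕ.≤-trans d<x x≤y)))) neq
  ...   | inj₁ x<y = inj₁ (inj₂ (d , d<x , ℕ.≤-trans d<x x≤y , eq , x<y))
  ...   | inj₂ y<x = inj₂ (inj₂ (d , ℕ.≤-trans d<x x≤y , d<x , sym eq , y<x))

  <ᵛ-total : x ≢ y → x <ᵛ y ⊎ y <ᵛ x
  <ᵛ-total {x} {y} x≢y with ℕ.≤-total (length x) (length y)
  ... | inj₁ x≤y = <ᵛ-total-≤ x≤y x≢y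
  ... | inj₂ y≤x = swap (<ᵛ-total-≤ y≤x (x≢y ∘ sym))

  <ᵛ-cmp : Trichotomous _≡_ _<ᵛ_
  <ᵛ-cmp x y with ≡-dec _≟_ x y
  ... | yes refl = tri≈ <ᵛ-irrefl refl <ᵛ-irrefl
  ... | no x≢y with <ᵛ-total x≢y
  ...   | inj₁ x<y = tri< x<y x≢y (<ᵛ-asym x<y)
  ...   | inj₂ y<x = tri> (<ᵛ-asym y<x) x≢y y<x

  meet⇒BranchLess : ∀ s t → iter (suc s) x ≡ iter (suc t) y → LastDiffLess (iter s x) (iter t y) →
                    BranchLess x y
  meet⇒BranchLess {x} {y} s t meet x<y with LastDiffLess⇒length x<y
  ... | d , |sx| , |ty| =
    d , ℕ.≤-trans (ℕ.≤-reflexive (sym |sx|)) (length-iter-≤ s x) ,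
        ℕ.≤-trans (ℕ.≤-reflexive (sym |ty|)) (length-iter-≤ t y) ,
        trans (sym (iter-ancestor (suc s) x (shorter {r = s} |sx|)))
          (trans meet (iter-ancestor (suc t) y (shorter {r = t} |ty|))) ,
        subst₂ LastDiffLess (iter-ancestor s x |sx|) (iter-ancestor t y |ty|) x<y
    where
      shorter : ∀ {n} {r} {z : Str σ} → length (iter r z) ≡ suc n → length (iter (suc r) z) ≡ n
      shorter {r = r} {z} eq = trans (length-star (iter r z)) (cong pred eq)

  BranchLess⇒meet : ((d , _) : BranchLess x y) →
                    iter (suc (length x ∸ suc d)) x ≡ iter (suc (length y ∸ suc d)) y
  BranchLess⇒meet {x} {y} (d , d<x , d<y , eq , _) = trans (one-up x d<x) (trans eq (sym (one-up y d<y)))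
    where
      one-up : ∀ (z : Str σ) → d < length z → iter (suc (length z ∸ suc d)) z ≡ ancestor d z
      one-up z d<z = cong (λ k → iter k z) (sym (ℕ.+-∸-assoc 1 d<z))

  BranchLess⇒meet-minimal : ((d , _) : BranchLess x y) → ∀ s t → iter (suc s) x ≡ iter (suc t) y →
                            length x ∸ suc d ≤ s × length y ∸ suc d ≤ t
  BranchLess⇒meet-minimal {x} {y} br@(d , _) s t meet =
    ∸-flip (length x) (subst (_≤ d) (length-iter (suc s) x) m≤d) ,
    ∸-flip (length y) (subst (_≤ d) (trans (cong length meet) (length-iter (suc t) y)) m≤d)
    where
      m : ℕ
      m = length (iter (suc s) x)
      m≡ : length (iter (suc t) y) ≡ m
      m≡ = cong length (sym meet)
      m≤d : m ≤ d
      m≤d = BranchLess⇒common-length≤ br m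
              (length-iter-≤ (suc s) x) (subst (_≤ length y) m≡ (length-iter-≤ (suc t) y))
              (trans (sym (iter-ancestor (suc s) x refl)) (trans meet (iter-ancestor (suc t) y m≡)))
      ∸-flip : ∀ n {a b} → n ∸ suc a ≤ b → n ∸ suc b ≤ a
      ∸-flip n {a} {b} le = ℕ.m≤n+o⇒m∸n≤o n (suc b) (subst (n ≤_) (cong suc (ℕ.+-comm a b))
                              (ℕ.≤-trans (ℕ.m≤n+m∸n n (suc a)) (ℕ.+-monoʳ-≤ (suc a) le)))

  ≺⇒<ᵛ : x ≺ y → x <ᵛ y
  ≺⇒<ᵛ {x} {y} (x≢y , inj₁ x∈y) =
    inj₁ (ℕ.≤∧≢⇒< (Occurs⇒length≤ x∈y) |x|≢|y| , Occurs⇒ancestor x∈y)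
    where
      |x|≢|y| : length x ≢ length y
      |x|≢|y| eq = x≢y (trans (sym (Occurs⇒ancestor x∈y))
                         (trans (cong (λ k → ancestor k y) eq) (ancestor-length y)))
  ≺⇒<ᵛ (_ , inj₂ (_ , _ , s , t , (meet , _) , x<y)) = inj₂ (meet⇒BranchLess s t meet x<y)

  <ᵛ⇒≺ : x <ᵛ y → x ≺ y
  <ᵛ⇒≺ x<y@(inj₁ x⊏y) = (λ { refl → <ᵛ-irrefl x<y }) , inj₁ (⊏⇒Occurs x⊏y)
  <ᵛ⇒≺ x<y@(inj₂ br@(_ , _ , _ , _ , branch)) = (λ { refl → <ᵛ-irrefl x<y }) , inj₂
    (flip Occurs⇒¬BranchLess br , flip Occurs⇒¬BranchLess⁻¹ br , _ , _ ,
     (BranchLess⇒meet br , BranchLess⇒meet-minimal br) , branch)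

  ≺⇔<ᵛ : (x ≺ y) ⇔ (x <ᵛ y)
  ≺⇔<ᵛ = mk⇔ ≺⇒<ᵛ <ᵛ⇒≺

  -- Splitting at the last occurrence of the largest letter

  nondec-++ : ∀ (u : Str σ) {v} → nondec v ≡ false → nondec (u ++ v) ≡ false
  nondec-++ [] eq = eq
  nondec-++ (a ∷ []) {b ∷ v} eq = trans (cong (does (a ≤ᶠ? b) ∧_) eq) (∧-zeroʳ _)
  nondec-++ (a ∷ b ∷ u) eq = trans (cong (does (a ≤ᶠ? b) ∧_) (nondec-++ (b ∷ u) eq)) (∧-zeroʳ _)

  star-++ : ∀ (u : Str σ) {v} → nondec v ≡ false → star (u ++ v) ≡ u ++ star v
  star-++ [] eq = refl
  star-++ (a ∷ u) eq = trans (star-¬nondec a (u ++ _) (nondec-++ (a ∷ u) eq)) (cong (a ∷_) (star-++ u eq))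

  -- A descent L > c makes * delete a letter to the right of L.
  star-++-below : ∀ (w : Str σ) {q} → All (_<ᶠ L) q → q ≢ [] → star (w ++ L ∷ q) ≡ w ++ L ∷ star q
  star-++-below w {[]} _ q≢[] = ⊥-elim (q≢[] refl)
  star-++-below {L} w {c ∷ q} (c<L ∷ _) _ =
    trans (star-++ w descent) (cong (w ++_) (star-¬nondec L (c ∷ q) descent))
    where
      descent : nondec (L ∷ c ∷ q) ≡ false
      descent = cong (_∧ nondec (c ∷ q)) (dec-false (L ≤ᶠ? c) (ℕ.<⇒≱ c<L))

  nondec-∷ʳ-max : ∀ a (w : Str σ) → All (_≤ᶠ L) (a ∷ w) → nondec (a ∷ w ++ [ L ]) ≡ nondec (a ∷ w)
  nondec-∷ʳ-max {L} a [] (a≤L ∷ []) = cong (_∧ true) (dec-true (a ≤ᶠ? L) a≤L)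
  nondec-∷ʳ-max a (b ∷ w) (_ ∷ ps) = cong (does (a ≤ᶠ? b) ∧_) (nondec-∷ʳ-max b w ps)

  star-∷ʳ-max : ∀ (q : Str σ) → All (_≤ᶠ L) q → q ≢ [] → star (q ++ [ L ]) ≡ star q ++ [ L ]
  star-∷ʳ-max [] _ q≢[] = ⊥-elim (q≢[] refl)
  star-∷ʳ-max {L} (a ∷ q) ps _ with starStep a q
  ... | drop-head nd eq = trans (star-nondec a _ (trans (nondec-∷ʳ-max a q ps) nd)) (cong (_++ [ L ]) (sym eq))
  star-∷ʳ-max {L} (a ∷ b ∷ q) ps@(_ ∷ bq≤L) _ | keep-head nd eq = begin
    star (a ∷ b ∷ q ++ [ L ])   ≡⟨ star-¬nondec a _ (trans (nondec-∷ʳ-max a (b ∷ q) ps) nd) ⟩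
    a ∷ star (b ∷ q ++ [ L ])   ≡⟨ cong (a ∷_) (star-∷ʳ-max (b ∷ q) bq≤L (λ ())) ⟩
    a ∷ star (b ∷ q) ++ [ L ]   ≡⟨ cong (_++ [ L ]) eq ⟨
    star (a ∷ b ∷ q) ++ [ L ]   ∎
    where open ≡-Reasoning

  iter-++-below : ∀ (w : Str σ) {z} → All (_<ᶠ L) z → ∀ s → s ≤ length z →
                  iter s (w ++ L ∷ z) ≡ w ++ L ∷ iter s z
  iter-++-below w z<L zero _ = refl
  iter-++-below {L} w {z} z<L (suc s) s<z = begin
    star (iter s (w ++ L ∷ z)) ≡⟨ cong star (iter-++-below w z<L s (ℕ.<⇒≤ s<z)) ⟩
    star (w ++ L ∷ iter s z)   ≡⟨ star-++-below w (All-iter s z z<L) (iter-nonempty s z s<z) ⟩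
    w ++ L ∷ star (iter s z)   ∎
    where open ≡-Reasoning

  iter-∷ʳ-max : ∀ {w : Str σ} → All (_≤ᶠ L) w → ∀ s → s ≤ length w →
                iter s (w ++ [ L ]) ≡ iter s w ++ [ L ]
  iter-∷ʳ-max w≤L zero _ = refl
  iter-∷ʳ-max {L} {w} w≤L (suc s) s<w = begin
    star (iter s (w ++ [ L ])) ≡⟨ cong star (iter-∷ʳ-max w≤L s (ℕ.<⇒≤ s<w)) ⟩
    star (iter s w ++ [ L ])   ≡⟨ star-∷ʳ-max (iter s w) (All-iter s w w≤L) (iter-nonempty s w s<w) ⟩
    star (iter s w) ++ [ L ]   ∎
    where open ≡-Reasoning

  -- x = w L z with L the largest letter of x and z = x_k the last block of its V-form.
  LastMax : Fin σ → Str σ → Str σ → Set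
  LastMax L w z = All (_≤ᶠ L) w × All (_<ᶠ L) z

  ≤ᶠ⇒<ᶠ⊎≡ : a ≤ᶠ b → a <ᶠ b ⊎ a ≡ b
  ≤ᶠ⇒<ᶠ⊎≡ a≤b with ℕ.m≤n⇒m<n∨m≡n a≤b
  ... | inj₁ a<b = inj₁ a<b
  ... | inj₂ a≡b = inj₂ (Fin.toℕ-injective a≡b)

  All-≤-trans : a ≤ᶠ b → All (_≤ᶠ a) x → All (_≤ᶠ b) x
  All-≤-trans a≤b = All.map (λ c≤a → Fin.≤-trans c≤a a≤b)

  All-≤-<-trans : a <ᶠ b → All (_≤ᶠ a) x → All (_<ᶠ b) x
  All-≤-<-trans a<b = All.map (λ c≤a → ℕ.≤-<-trans c≤a a<b)

  All-<-≤-trans : a ≤ᶠ b → All (_<ᶠ a) x → All (_<ᶠ b) x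
  All-<-≤-trans a≤b = All.map (λ c<a → ℕ.<-≤-trans c<a a≤b)

  lastMax-All : LastMax L w z → All (_≤ᶠ L) (w ++ L ∷ z)
  lastMax-All (w≤L , z<L) = ++⁺ w≤L (Fin.≤-refl ∷ All.map ℕ.<⇒≤ z<L)

  All-middle : ∀ {P : Fin σ → Set} (w : Str σ) → All P (w ++ L ∷ z) → P L
  All-middle w p = All.head (++⁻ʳ w p)

  lastMax-prefix-∷ : LastMax L w z → l ≤ᶠ L → LastMax L (l ∷ w) z
  lastMax-prefix-∷ (w≤L , z<L) l≤L = l≤L ∷ w≤L , z<L

  lastMax-prefix-∷ʳ : LastMax L w z → l ≤ᶠ L → LastMax L (w ++ [ l ]) z
  lastMax-prefix-∷ʳ (w≤L , z<L) l≤L = ∷ʳ⁺ w≤L l≤L , z<L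

  lastMax-suffix-∷ : LastMax L w z → l <ᶠ L → LastMax L w (l ∷ z)
  lastMax-suffix-∷ (w≤L , z<L) l<L = w≤L , l<L ∷ z<L

  lastMax-suffix-∷ʳ : LastMax L w z → l <ᶠ L → LastMax L w (z ++ [ l ])
  lastMax-suffix-∷ʳ (w≤L , z<L) l<L = w≤L , ∷ʳ⁺ z<L l<L

  -- The sequence of w L z first shortens z to ε and then shortens w, keeping L last.
  ancestor-++-≤ : LastMax L w z → ∀ e → e ≤ length w →
                  ancestor (suc e) (w ++ L ∷ z) ≡ ancestor e w ++ [ L ]
  ancestor-++-≤ {L} {w} {z} (w≤L , z<L) e e≤w = begin
    iter (length (w ++ L ∷ z) ∸ suc e) (w ++ L ∷ z)
      ≡⟨ cong (λ k → iter k (w ++ L ∷ z)) |x|∸1+e ⟩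
    iter ((length w ∸ e) + length z) (w ++ L ∷ z)
      ≡⟨ iter-+ (length w ∸ e) (length z) (w ++ L ∷ z) ⟩
    iter (length w ∸ e) (iter (length z) (w ++ L ∷ z))
      ≡⟨ cong (iter (length w ∸ e)) (iter-++-below w z<L (length z) ℕ.≤-refl) ⟩
    iter (length w ∸ e) (w ++ L ∷ iter (length z) z)
      ≡⟨ cong (λ q → iter (length w ∸ e) (w ++ L ∷ q)) (iter-≥length (length z) z ℕ.≤-refl) ⟩
    iter (length w ∸ e) (w ++ [ L ])
      ≡⟨ iter-∷ʳ-max w≤L (length w ∸ e) (ℕ.m∸n≤m (length w) e) ⟩
    ancestor e w ++ [ L ] ∎
    where
      open ≡-Reasoning
      |x|∸1+e : length (w ++ L ∷ z) ∸ suc e ≡ (length w ∸ e) + length z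
      |x|∸1+e = trans (cong (_∸ suc e) (trans (length-++ w) (ℕ.+-suc (length w) (length z))))
                      (ℕ.+-∸-comm (length z) e≤w)

  ancestor-++-> : ∀ (w : Str σ) → All (_<ᶠ L) z → ∀ e → e ≤ length z →
                  ancestor (length w + suc e) (w ++ L ∷ z) ≡ w ++ L ∷ ancestor e z
  ancestor-++-> {L} {z} w z<L e e≤z = begin
    iter (length (w ++ L ∷ z) ∸ (length w + suc e)) (w ++ L ∷ z)
      ≡⟨ cong (λ k → iter (k ∸ (length w + suc e)) (w ++ L ∷ z)) (length-++ w) ⟩
    iter ((length w + suc (length z)) ∸ (length w + suc e)) (w ++ L ∷ z)
      ≡⟨ cong (λ k → iter k (w ++ L ∷ z)) (ℕ.[m+n]∸[m+o]≡n∸o (length w) (suc (length z)) (suc e)) ⟩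
    iter (length z ∸ e) (w ++ L ∷ z)
      ≡⟨ iter-++-below w z<L (length z ∸ e) (ℕ.m∸n≤m (length z) e) ⟩
    w ++ L ∷ ancestor e z ∎
    where open ≡-Reasoning

  ancestor-lastMax : LastMax L w z → ancestor (suc (length w)) (w ++ L ∷ z) ≡ w ++ [ L ]
  ancestor-lastMax {w = w} split =
    trans (ancestor-++-≤ split (length w) ℕ.≤-refl) (cong (_++ _) (ancestor-length w))

  ancestor-prefix-⊏ : LastMax L w′ z′ → length w < length w′ → ancestor (length w) w′ ≡ w →
                      ancestor (suc (length w)) (w′ ++ L ∷ z′) ≡ w ++ [ L ]
  ancestor-prefix-⊏ split′ w<w′ eq = trans (ancestor-++-≤ split′ _ (ℕ.<⇒≤ w<w′)) (cong (_++ _) eq)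

  length-prefix< : ∀ (w : Str σ) L z → length w < length (w ++ L ∷ z)
  length-prefix< w L z = subst (length w <_) (sym (length-++ w)) (ℕ.m<m+n (length w) (s≤s z≤n))

  length-suffix< : ∀ (w : Str σ) L z → length z < length (w ++ L ∷ z)
  length-suffix< w L z = subst (length z <_) (sym (length-++ w)) (ℕ.m≤n+m (suc (length z)) (length w))

  length-∷ʳ : ∀ (w : Str σ) L → length (w ++ [ L ]) ≡ suc (length w)
  length-∷ʳ w L = trans (length-++ w) (ℕ.+-comm (length w) 1)

  ancestor-1-lastMax : LastMax L w z → ancestor 1 (w ++ L ∷ z) ≡ [ L ]
  ancestor-1-lastMax {w = w} split = trans (ancestor-++-≤ split 0 z≤n) (cong (_++ _) (ancestor-0 w))

  ancestor-1-below : All (_<ᶠ L) z → 0 < length z → Σ (Fin σ) λ c → c <ᶠ L × ancestor 1 z ≡ [ c ]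
  ancestor-1-below {z = z} z<L 0<z with ancestor 1 z | length-ancestor 1 z 0<z | All-iter (length z ∸ 1) z z<L
  ... | c ∷ [] | _ | c<L ∷ [] = c , c<L , refl

  data SplitLess : Str σ → Fin σ → Str σ → Str σ → Fin σ → Str σ → Set where
    top<    : ∀ {w z w′ z′} → L <ᶠ L′ → SplitLess w L z w′ L′ z′
    prefix< : ∀ {w z w′ z′} → w <ᵛ w′ → SplitLess w L z w′ L z′
    suffix< : ∀ {w z z′} → z <ᵛ z′ → SplitLess w L z w L z′

  top<⇒<ᵛ : LastMax L w z → LastMax L′ w′ z′ → L <ᶠ L′ → w ++ L ∷ z <ᵛ w′ ++ L′ ∷ z′
  top<⇒<ᵛ {L} {w} {z} {L′} {w′} {z′} split split′ L<L′ =
    inj₂ (0 , ℕ.≤-<-trans z≤n (length-suffix< w L z) , ℕ.≤-<-trans z≤n (length-suffix< w′ L′ z′) ,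
          trans (ancestor-0 (w ++ L ∷ z)) (sym (ancestor-0 (w′ ++ L′ ∷ z′))) ,
          subst₂ LastDiffLess (sym (ancestor-1-lastMax split)) (sym (ancestor-1-lastMax split′))
            ([] , [] , [] , L , L′ , refl , refl , refl , L<L′))

  suffix<⇒<ᵛ : ∀ (w : Str σ) → All (_<ᶠ L) z → All (_<ᶠ L) z′ → z <ᵛ z′ →
               w ++ L ∷ z <ᵛ w ++ L ∷ z′
  suffix<⇒<ᵛ {L} {z} {z′} w z<L z′<L (inj₁ (|z|<|z′| , eq)) = inj₁
    (subst₂ _<_ (sym (length-++ w)) (sym (length-++ w)) (ℕ.+-monoʳ-< (length w) (s≤s |z|<|z′|)) ,
     trans (cong (λ k → ancestor k (w ++ L ∷ z′)) (length-++ w))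
       (trans (ancestor-++-> w z′<L (length z) (ℕ.<⇒≤ |z|<|z′|)) (cong (λ q → w ++ L ∷ q) eq)))
  suffix<⇒<ᵛ {L} {z} {z′} w z<L z′<L (inj₂ (d , d<z , d<z′ , eq , z<z′)) = inj₂
    (length w + suc d , deeper d<z , deeper d<z′ ,
     trans (ancestor-++-> w z<L d (ℕ.<⇒≤ d<z))
       (trans (cong (λ q → w ++ L ∷ q) eq) (sym (ancestor-++-> w z′<L d (ℕ.<⇒≤ d<z′)))) ,
     subst₂ LastDiffLess (sym (one-deeper z<L d<z)) (sym (one-deeper z′<L d<z′))
       (LastDiffLess-++ˡ w (LastDiffLess-++ˡ [ L ] z<z′)))
    where
      deeper : ∀ {q} → d < length q → length w + suc d < length (w ++ L ∷ q)
      deeper d<q = subst (_ <_) (sym (length-++ w)) (ℕ.+-monoʳ-< (length w) (s≤s d<q))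
      one-deeper : ∀ {q} → All (_<ᶠ L) q → d < length q →
                   ancestor (suc (length w + suc d)) (w ++ L ∷ q) ≡ w ++ L ∷ ancestor (suc d) q
      one-deeper {q} q<L d<q = trans (cong (λ k → ancestor k (w ++ L ∷ q)) (sym (ℕ.+-suc (length w) (suc d))))
                                 (ancestor-++-> w q<L (suc d) d<q)

  prefix-branch⇒<ᵛ : LastMax L w z → LastMax L w′ z′ → BranchLess w w′ → w ++ L ∷ z <ᵛ w′ ++ L ∷ z′
  prefix-branch⇒<ᵛ {L} {w} {z} {w′} {z′} split split′ (d , d<w , d<w′ , eq , w<w′) = inj₂
    (suc d , ℕ.≤-<-trans d<w (length-prefix< w L z) , ℕ.≤-<-trans d<w′ (length-prefix< w′ L z′) ,
     trans (ancestor-++-≤ split d (ℕ.<⇒≤ d<w))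
       (trans (cong (_++ [ L ]) eq) (sym (ancestor-++-≤ split′ d (ℕ.<⇒≤ d<w′)))) ,
     subst₂ LastDiffLess (sym (ancestor-++-≤ split (suc d) d<w)) (sym (ancestor-++-≤ split′ (suc d) d<w′))
       (LastDiffLess-++ʳ [ L ] w<w′))

  -- If w ⊏ w′ then w L is a member of the sequence of w′ L z′, and the letter following
  -- w L in w L z (if any) is below L.
  prefix⊏⇒<ᵛ : LastMax L w z → LastMax L w′ z′ → w ⊏ w′ → w ++ L ∷ z <ᵛ w′ ++ L ∷ z′
  prefix⊏⇒<ᵛ {L} {w} {[]} {w′} {z′} split split′ (w<w′ , eq) = inj₁
    (subst (_< _) (sym (length-∷ʳ w L)) (ℕ.≤-<-trans w<w′ (length-prefix< w′ L z′)) ,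
     trans (cong (λ k → ancestor k _) (length-∷ʳ w L)) (ancestor-prefix-⊏ split′ w<w′ eq))
  prefix⊏⇒<ᵛ {L} {w} {z@(_ ∷ _)} {w′} {z′} split@(_ , z<L) split′ (w<w′ , eq)
    with ancestor-1-below z<L (s≤s z≤n)
  ... | c , c<L , anc₁ = inj₂
    (suc (length w) ,
     subst₂ _<_ (ℕ.+-comm (length w) 1) (sym (length-++ w)) (ℕ.+-monoʳ-< (length w) (s≤s (s≤s z≤n))) ,
     ℕ.≤-<-trans w<w′ (length-prefix< w′ L z′) ,
     trans (ancestor-lastMax split) (sym (ancestor-prefix-⊏ split′ w<w′ eq)) ,
     subst₂ LastDiffLess (sym ancx) (sym (ancestor-++-≤ split′ (suc (length w)) w<w′))
       (w ++ [ L ] , ancestor (suc (length w)) w′ , [] , c , L , sym (++-assoc w [ L ] [ c ]) , refl ,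
        trans (length-∷ʳ w L) (sym (length-ancestor (suc (length w)) w′ w<w′)) , c<L))
    where
      ancx : ancestor (suc (suc (length w))) (w ++ L ∷ z) ≡ w ++ L ∷ [ c ]
      ancx = trans (cong (λ k → ancestor k (w ++ L ∷ z)) (ℕ.+-comm 2 (length w)))
               (trans (ancestor-++-> w z<L 1 (s≤s z≤n)) (cong (λ q → w ++ L ∷ q) anc₁))


  SplitLess⇒<ᵛ : LastMax L w z → LastMax L′ w′ z′ →
                 SplitLess w L z w′ L′ z′ → w ++ L ∷ z <ᵛ w′ ++ L′ ∷ z′
  SplitLess⇒<ᵛ split split′ (top< L<L′) = top<⇒<ᵛ split split′ L<L′
  SplitLess⇒<ᵛ split split′ (prefix< (inj₁ w⊏w′)) = prefix⊏⇒<ᵛ split split′ w⊏w′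
  SplitLess⇒<ᵛ split split′ (prefix< (inj₂ w<w′)) = prefix-branch⇒<ᵛ split split′ w<w′
  SplitLess⇒<ᵛ {w = w} (_ , z<L) (_ , z′<L) (suffix< z<z′) = suffix<⇒<ᵛ w z<L z′<L z<z′

  SplitLess-mapˡ : (f : Str σ → Str σ) → (w <ᵛ w′ → f w <ᵛ f w′) →
                   SplitLess w L z w′ L′ z′ → SplitLess (f w) L z (f w′) L′ z′
  SplitLess-mapˡ f g (top< L<L′) = top< L<L′
  SplitLess-mapˡ f g (prefix< w<w′) = prefix< (g w<w′)
  SplitLess-mapˡ f g (suffix< z<z′) = suffix< z<z′

  SplitLess-mapʳ : (f : Str σ → Str σ) → (z <ᵛ z′ → f z <ᵛ f z′) →
                   SplitLess w L z w′ L′ z′ → SplitLess w L (f z) w′ L′ (f z′)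
  SplitLess-mapʳ f g (top< L<L′) = top< L<L′
  SplitLess-mapʳ f g (prefix< w<w′) = prefix< w<w′
  SplitLess-mapʳ f g (suffix< z<z′) = suffix< (g z<z′)

  <ᵛ⇒SplitLess : LastMax L w z → LastMax L′ w′ z′ →
                 w ++ L ∷ z <ᵛ w′ ++ L′ ∷ z′ → SplitLess w L z w′ L′ z′
  <ᵛ⇒SplitLess {L} {w} {z} {L′} {w′} {z′} split split′ x<y with Fin.<-cmp L L′
  ... | tri< L<L′ _ _ = top< L<L′
  ... | tri> _ _ L′<L = ⊥-elim (<ᵛ-asym x<y (top<⇒<ᵛ split′ split L′<L))
  ... | tri≈ _ refl _ with <ᵛ-cmp w w′
  ...   | tri< w<w′ _ _ = prefix< w<w′
  ...   | tri> _ _ w′<w = ⊥-elim (<ᵛ-asym x<y (SplitLess⇒<ᵛ split′ split (prefix< w′<w)))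
  ...   | tri≈ _ refl _ with <ᵛ-cmp z z′
  ...     | tri< z<z′ _ _ = suffix< z<z′
  ...     | tri≈ _ refl _ = ⊥-elim (<ᵛ-irrefl x<y)
  ...     | tri> _ _ z′<z = ⊥-elim (<ᵛ-asym x<y (SplitLess⇒<ᵛ split′ split (suffix< z′<z)))

  <ᵛ-mapˡ : (f : Str σ → Str σ) → LastMax L w z → LastMax L′ w′ z′ →
            LastMax L (f w) z → LastMax L′ (f w′) z′ → (w <ᵛ w′ → f w <ᵛ f w′) →
            w ++ L ∷ z <ᵛ w′ ++ L′ ∷ z′ → f w ++ L ∷ z <ᵛ f w′ ++ L′ ∷ z′
  <ᵛ-mapˡ f split split′ fsplit fsplit′ mono x<y =
    SplitLess⇒<ᵛ fsplit fsplit′ (SplitLess-mapˡ f mono (<ᵛ⇒SplitLess split split′ x<y))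

  <ᵛ-mapʳ : (f : Str σ → Str σ) → LastMax L w z → LastMax L′ w′ z′ →
            LastMax L w (f z) → LastMax L′ w′ (f z′) → (z <ᵛ z′ → f z <ᵛ f z′) →
            w ++ L ∷ z <ᵛ w′ ++ L′ ∷ z′ → w ++ L ∷ f z <ᵛ w′ ++ L′ ∷ f z′
  <ᵛ-mapʳ f split split′ fsplit fsplit′ mono x<y =
    SplitLess⇒<ᵛ fsplit fsplit′ (SplitLess-mapʳ f mono (<ᵛ⇒SplitLess split split′ x<y))

  count-≡ : ∀ M (x : Str σ) → count M (M ∷ x) ≡ suc (count M x)
  count-≡ M x = cong (λ b → if b then suc (count M x) else count M x) (dec-true (M ≟ M) refl)

  below⇒count≡0 : All (_<ᶠ M) x → count M x ≡ 0
  below⇒count≡0 [] = refl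
  below⇒count≡0 {M} {c ∷ x} (c<M ∷ x<M) with c ≟ M
  ... | yes refl = ⊥-elim (Fin.<-irrefl refl c<M)
  ... | no _ = below⇒count≡0 x<M

  count≡0⇒below : All (_≤ᶠ M) x → count M x ≡ 0 → All (_<ᶠ M) x
  count≡0⇒below [] _ = []
  count≡0⇒below {M} {c ∷ x} (c≤M ∷ x≤M) eq with c ≟ M
  ... | no c≢M = Fin.≤∧≢⇒< c≤M c≢M ∷ count≡0⇒below x≤M eq

  count-lastMax : ∀ (w : Str σ) → All (_<ᶠ M) z → count M (w ++ M ∷ z) ≡ suc (count M w)
  count-lastMax {M} {z} [] z<M = trans (count-≡ M z) (cong suc (below⇒count≡0 z<M))
  count-lastMax {M} (c ∷ w) z<M with c ≟ M
  ... | yes _ = cong suc (count-lastMax w z<M)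
  ... | no _ = count-lastMax w z<M

  count-prefix-≡ : LastMax M w z → LastMax M w′ z′ →
                   count M (w ++ M ∷ z) ≡ count M (w′ ++ M ∷ z′) → count M w ≡ count M w′
  count-prefix-≡ {w = w} {w′ = w′} (_ , z<M) (_ , z′<M) eq =
    ℕ.suc-injective (trans (sym (count-lastMax w z<M)) (trans eq (count-lastMax w′ z′<M)))

  count-prefix-< : LastMax M w z → LastMax M w′ z′ →
                   count M (w ++ M ∷ z) < count M (w′ ++ M ∷ z′) → count M w < count M w′
  count-prefix-< {w = w} {w′ = w′} (_ , z<M) (_ , z′<M) lt =
    ℕ.≤-pred (subst₂ _<_ (count-lastMax w z<M) (count-lastMax w′ z′<M) lt)

  count-∈ : M ∈ x → 0 < count M x
  count-∈ {M} {c ∷ x} (here refl) = subst (0 <_) (sym (count-≡ M x)) (s≤s z≤n)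
  count-∈ {M} {c ∷ x} (there M∈x) with c ≟ M
  ... | yes _ = s≤s z≤n
  ... | no _ = count-∈ M∈x

  maxLetter-cases : ∀ (a b : Fin σ) → (a ≤ᶠ b × maxLetter a b ≡ b) ⊎ (b <ᶠ a × maxLetter a b ≡ a)
  maxLetter-cases a b with a ≤ᶠ? b in eq
  ... | yes a≤b = inj₁ (a≤b , cong (λ t → if does t then b else a) eq)
  ... | no a≰b = inj₂ (ℕ.≰⇒> a≰b , cong (λ t → if does t then b else a) eq)

  maxLetter-≤ˡ : ∀ (a b : Fin σ) → a ≤ᶠ maxLetter a b
  maxLetter-≤ˡ a b with maxLetter-cases a b
  ... | inj₁ (a≤b , eq) = subst (a ≤ᶠ_) (sym eq) a≤b
  ... | inj₂ (_ , eq) = subst (a ≤ᶠ_) (sym eq) Fin.≤-refl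

  maxLetter-≤ʳ : ∀ (a b : Fin σ) → b ≤ᶠ maxLetter a b
  maxLetter-≤ʳ a b with maxLetter-cases a b
  ... | inj₁ (_ , eq) = subst (b ≤ᶠ_) (sym eq) Fin.≤-refl
  ... | inj₂ (b<a , eq) = subst (b ≤ᶠ_) (sym eq) (ℕ.<⇒≤ b<a)

  maxLetter-sel : ∀ (a b : Fin σ) → maxLetter a b ≡ a ⊎ maxLetter a b ≡ b
  maxLetter-sel a b with maxLetter-cases a b
  ... | inj₁ (_ , eq) = inj₂ eq
  ... | inj₂ (_ , eq) = inj₁ eq

  ≤maxLetter : ∀ (a b : Fin σ) → l ≤ᶠ maxLetter a b → l ≤ᶠ a ⊎ l ≤ᶠ b
  ≤maxLetter {l} a b l≤ with maxLetter-sel a b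
  ... | inj₁ eq = inj₁ (subst (l ≤ᶠ_) eq l≤)
  ... | inj₂ eq = inj₂ (subst (l ≤ᶠ_) eq l≤)

  ≤-one-of : l ≤ᶠ a ⊎ l ≤ᶠ b → a ≤ᶠ b → l ≤ᶠ b
  ≤-one-of (inj₁ l≤a) a≤b = Fin.≤-trans l≤a a≤b
  ≤-one-of (inj₂ l≤b) _ = l≤b

  𝓛-All : ∀ a (as : Str σ) → All (_≤ᶠ 𝓛 a as) (a ∷ as)
  𝓛-All a [] = Fin.≤-refl ∷ []
  𝓛-All a (b ∷ bs) = maxLetter-≤ˡ a (𝓛 b bs) ∷ All-≤-trans (maxLetter-≤ʳ a (𝓛 b bs)) (𝓛-All b bs)

  𝓛-∈ : ∀ a (as : Str σ) → 𝓛 a as ∈ a ∷ as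
  𝓛-∈ a [] = here refl
  𝓛-∈ a (b ∷ bs) with maxLetter-sel a (𝓛 b bs)
  ... | inj₁ eq = here eq
  ... | inj₂ eq = there (subst (_∈ b ∷ bs) (sym eq) (𝓛-∈ b bs))

  data LastMaxSplit (M : Fin σ) : Str σ → Set where
    lastMaxSplit : LastMax M w z → LastMaxSplit M (w ++ M ∷ z)

  split-at : All (_≤ᶠ M) x → 0 < count M x → LastMaxSplit M x
  split-at {M} {c ∷ x} (c≤M ∷ x≤M) 0<cnt with count M x ℕ.≟ 0
  ... | no cnt≢0 with split-at x≤M (ℕ.n≢0⇒n>0 cnt≢0)
  ...   | lastMaxSplit (w≤M , z<M) = lastMaxSplit (c≤M ∷ w≤M , z<M)
  split-at {M} {c ∷ x} (c≤M ∷ x≤M) 0<cnt | yes cnt≡0 with c ≟ M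
  ... | yes refl = lastMaxSplit {w = []} ([] , count≡0⇒below x≤M cnt≡0)
  ... | no _ = ⊥-elim (ℕ.<-irrefl (sym cnt≡0) 0<cnt)

  data TopView : Str σ → Set where
    empty : TopView []
    topSplit : LastMax L w z → TopView (w ++ L ∷ z)

  topView : ∀ (x : Str σ) → TopView x
  topView [] = empty
  topView (a ∷ as) = fromSplit (split-at (𝓛-All a as) (count-∈ (𝓛-∈ a as)))
    where
      fromSplit : LastMaxSplit L x → TopView x
      fromSplit (lastMaxSplit s) = topSplit s

  []<ᵛ : 0 < length x → [] <ᵛ x
  []<ᵛ {x} 0<x = inj₁ (0<x , ancestor-0 x)

  below<ᵛ : All (_<ᶠ M) x → LastMax M w′ z′ → x <ᵛ w′ ++ M ∷ z′
  below<ᵛ {M} {x} {w′} {z′} x<M split′ with topView x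
  ... | empty = []<ᵛ (ℕ.≤-<-trans z≤n (length-suffix< w′ M z′))
  ... | topSplit {w = w} s = top<⇒<ᵛ s split′ (All-middle w x<M)

  count-<⇒<ᵛ-acc : Acc _<_ (length x) → All (_≤ᶠ M) x → All (_≤ᶠ M) y → count M x < count M y → x <ᵛ y
  count-<⇒<ᵛ-acc {x} {M} (acc rec) x≤M y≤M x<y with split-at y≤M (ℕ.≤-<-trans z≤n x<y)
  ... | lastMaxSplit split′ with count M x ℕ.≟ 0
  ...   | yes x≡0 = below<ᵛ (count≡0⇒below x≤M x≡0) split′
  ...   | no x≢0 with split-at x≤M (ℕ.n≢0⇒n>0 x≢0)
  ...     | lastMaxSplit {w} {z} split = SplitLess⇒<ᵛ split split′ (prefix<
              (count-<⇒<ᵛ-acc (rec (length-prefix< w M z)) (proj₁ split) (proj₁ split′)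
                (count-prefix-< split split′ x<y)))

  count-<⇒<ᵛ : All (_≤ᶠ M) x → All (_≤ᶠ M) y → count M x < count M y → x <ᵛ y
  count-<⇒<ᵛ = count-<⇒<ᵛ-acc (<-wellFounded _)

  data SnocView (l : Fin σ) : Str σ → Set where
    bounded : All (_≤ᶠ l) x → SnocView l x
    above   : LastMax L w z → l <ᶠ L → SnocView l (w ++ L ∷ z)

  snocView : ∀ l (x : Str σ) → SnocView l x
  snocView l x with topView x
  ... | empty = bounded []
  ... | topSplit {L} s with L ≤ᶠ? l
  ...   | yes L≤l = bounded (All-≤-trans L≤l (lastMax-All s))
  ...   | no L≰l = above s (ℕ.≰⇒> L≰l)

  <ᵛ-∷ʳ-acc : Acc _<_ (length x) → x <ᵛ y → x ++ [ l ] <ᵛ y ++ [ l ]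
  <ᵛ-∷ʳ-acc {x} {y} {l} (acc rec) x<y with snocView l x | snocView l y
  ... | bounded x≤l | bounded y≤l = SplitLess⇒<ᵛ (x≤l , []) (y≤l , []) (prefix< x<y)
  ... | bounded x≤l | above {w = w′} {z′} split′ l<L′ =
    subst (_ <ᵛ_) (sym (++-assoc w′ _ [ l ]))
      (below<ᵛ (All-≤-<-trans l<L′ (∷ʳ⁺ x≤l Fin.≤-refl)) (lastMax-suffix-∷ʳ split′ l<L′))
  ... | above split l<L | bounded y≤l = ⊥-elim (<ᵛ-asym x<y (below<ᵛ (All-≤-<-trans l<L y≤l) split))
  ... | above {w = w} {z} split l<L | above {w = w′} split′ l<L′ =
    subst₂ _<ᵛ_ (sym (++-assoc w _ [ l ])) (sym (++-assoc w′ _ [ l ]))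
      (<ᵛ-mapʳ (_++ [ l ]) split split′ (lastMax-suffix-∷ʳ split l<L) (lastMax-suffix-∷ʳ split′ l<L′)
        (<ᵛ-∷ʳ-acc (rec (length-suffix< w _ z))) x<y)

  <ᵛ-∷ʳ : x <ᵛ y → x ++ [ l ] <ᵛ y ++ [ l ]
  <ᵛ-∷ʳ = <ᵛ-∷ʳ-acc (<-wellFounded _)

  data ConsView (l : Fin σ) : Str σ → Set where
    below   : All (_<ᶠ l) x → ConsView l x
    reaches : LastMax L w z → l ≤ᶠ L → ConsView l (w ++ L ∷ z)

  consView : ∀ l (x : Str σ) → ConsView l x
  consView l x with topView x
  ... | empty = below []
  ... | topSplit {L} s with l ≤ᶠ? L
  ...   | yes l≤L = reaches s l≤L
  ...   | no l≰L = below (All-≤-<-trans (ℕ.≰⇒> l≰L) (lastMax-All s))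

  <ᵛ-∷-acc : Acc _<_ (length x) → x <ᵛ y → l ∷ x <ᵛ l ∷ y
  <ᵛ-∷-acc {x} {y} {l} (acc rec) x<y with consView l x | consView l y
  ... | below x<l | below y<l = SplitLess⇒<ᵛ {w = []} ([] , x<l) ([] , y<l) (suffix< x<y)
  ... | below x<l | reaches {L′} {w′} {z′} split′ l≤L′ =
    SplitLess⇒<ᵛ {w = []} ([] , x<l) (lastMax-prefix-∷ split′ l≤L′) top-or-prefix<
    where
      top-or-prefix< : SplitLess [] l x (l ∷ w′) L′ z′
      top-or-prefix< with ≤ᶠ⇒<ᶠ⊎≡ l≤L′
      ... | inj₁ l<L′ = top< l<L′
      ... | inj₂ refl = prefix< ([]<ᵛ (s≤s z≤n))
  ... | reaches split l≤L | below y<l = ⊥-elim (<ᵛ-asym x<y (below<ᵛ (All-<-≤-trans l≤L y<l) split))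
  ... | reaches {w = w} {z} split l≤L | reaches split′ l≤L′ =
    <ᵛ-mapˡ (l ∷_) split split′ (lastMax-prefix-∷ split l≤L) (lastMax-prefix-∷ split′ l≤L′)
      (<ᵛ-∷-acc (rec (length-prefix< w _ z))) x<y

  <ᵛ-∷ : x <ᵛ y → l ∷ x <ᵛ l ∷ y
  <ᵛ-∷ = <ᵛ-∷-acc (<-wellFounded _)

  data Insertion (l : Fin σ) : Str σ → Str σ → Set where
    insert : ∀ u v → Insertion l (u ++ v) (u ++ l ∷ v)

  Insertion-∷ : ∀ {l x x′} c → Insertion l x x′ → Insertion l (c ∷ x) (c ∷ x′)
  Insertion-∷ c (insert u v) = insert (c ∷ u) v

  count-++-∷ : ∀ (u : Str σ) {l v} → count M (u ++ l ∷ v) ≡ count M (l ∷ u ++ v)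
  count-++-∷ [] = refl
  count-++-∷ {M} (c ∷ u) {l} with c ≟ M | l ≟ M | count-++-∷ {M} u {l}
  ... | yes _ | yes _ | ih = cong suc ih
  ... | yes _ | no _  | ih = cong suc ih
  ... | no _  | yes _ | ih = ih
  ... | no _  | no _  | ih = ih

  Insertion-count : Insertion l x x′ → count M x′ ≡ count M (l ∷ x)
  Insertion-count (insert u v) = count-++-∷ u

  Insertion-All : ∀ {P : Fin σ → Set} → Insertion l x x′ → All P x → P l → All P x′
  Insertion-All (insert u v) p pl = ++⁺ (++⁻ˡ u p) (pl ∷ ++⁻ʳ u p)

  lastMax-Insertion : Insertion l w x′ → l ≤ᶠ M → LastMax M w z → LastMax M x′ z
  lastMax-Insertion ins l≤M (w≤M , z<M) = Insertion-All ins w≤M l≤M , z<M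

  insAfter-Insertion : ∀ L i l (x : Str σ) → i ≤ count L x → Insertion l x (insAfter L i l x)
  insAfter-Insertion L zero l [] _ = insert [] []
  insAfter-Insertion L zero l (c ∷ x) _ with c ≟ L
  ... | yes _ = insert [] (c ∷ x)
  ... | no _ = Insertion-∷ c (insAfter-Insertion L zero l x z≤n)
  insAfter-Insertion L (suc i) l (c ∷ x) i≤ with c ≟ L
  ... | yes _ = Insertion-∷ c (insAfter-Insertion L i l x (ℕ.≤-pred i≤))
  ... | no _ = Insertion-∷ c (insAfter-Insertion L (suc i) l x i≤)

  insBefore-Insertion : ∀ L i l (x : Str σ) → i ≤ count L x → Insertion l x (insBefore L i l x)
  insBefore-Insertion L zero l x _ = insert [] x
  insBefore-Insertion L (suc i) l (c ∷ x) i≤ with c ≟ L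
  ... | yes _ = Insertion-∷ c (insBefore-Insertion L i l x (ℕ.≤-pred i≤))
  ... | no _ = Insertion-∷ c (insBefore-Insertion L (suc i) l x i≤)

  insAfter-last : ∀ L i l (x : Str σ) → count L x ≡ i → insAfter L i l x ≡ x ++ [ l ]
  insAfter-last L i l [] refl = refl
  insAfter-last L zero l (c ∷ x) eq with c ≟ L
  ... | no _ = cong (c ∷_) (insAfter-last L zero l x eq)
  insAfter-last L (suc i) l (c ∷ x) eq with c ≟ L
  ... | yes _ = cong (c ∷_) (insAfter-last L i l x (ℕ.suc-injective eq))
  ... | no _ = cong (c ∷_) (insAfter-last L (suc i) l x eq)

  insAfter-++ : ∀ L i l (w : Str σ) z → i ≤ count L w →
                insAfter L i l (w ++ L ∷ z) ≡ insAfter L i l w ++ L ∷ z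
  insAfter-++ L zero l [] z _ with L ≟ L
  ... | yes _ = refl
  ... | no L≢L = ⊥-elim (L≢L refl)
  insAfter-++ L zero l (c ∷ w) z _ with c ≟ L
  ... | yes _ = refl
  ... | no _ = cong (c ∷_) (insAfter-++ L zero l w z z≤n)
  insAfter-++ L (suc i) l (c ∷ w) z i≤ with c ≟ L
  ... | yes _ = cong (c ∷_) (insAfter-++ L i l w z (ℕ.≤-pred i≤))
  ... | no _ = cong (c ∷_) (insAfter-++ L (suc i) l w z i≤)

  insBefore-++ : ∀ L i l (w : Str σ) z → i ≤ count L w →
                 insBefore L i l (w ++ L ∷ z) ≡ insBefore L i l w ++ L ∷ z
  insBefore-++ L zero l w z _ = refl
  insBefore-++ L (suc i) l (c ∷ w) z i≤ with c ≟ L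
  ... | yes _ = cong (c ∷_) (insBefore-++ L i l w z (ℕ.≤-pred i≤))
  ... | no _ = cong (c ∷_) (insBefore-++ L (suc i) l w z i≤)

  insBefore-last : ∀ L l (w : Str σ) z → insBefore L (suc (count L w)) l (w ++ L ∷ z) ≡ w ++ L ∷ l ∷ z
  insBefore-last L l [] z with L ≟ L
  ... | yes _ = refl
  ... | no L≢L = ⊥-elim (L≢L refl)
  insBefore-last L l (c ∷ w) z with c ≟ L
  ... | yes _ = cong (c ∷_) (insBefore-last L l w z)
  ... | no _ = cong (c ∷_) (insBefore-last L l w z)

  insAfter-<ᵛ-acc : Acc _<_ (length x) → l ≤ᶠ M → All (_≤ᶠ M) x → All (_≤ᶠ M) y →
                    i ≤ count M x → count M x ≡ count M y → x <ᵛ y → insAfter M i l x <ᵛ insAfter M i l y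
  insAfter-<ᵛ-acc {x} {l} {M} {y} {i} (acc rec) l≤M x≤M y≤M i≤x x≡y x<y with ℕ.m≤n⇒m<n∨m≡n i≤x
  ... | inj₂ refl =
    subst₂ _<ᵛ_ (sym (insAfter-last M _ l x refl)) (sym (insAfter-last M _ l y (sym x≡y))) (<ᵛ-∷ʳ x<y)
  ... | inj₁ i<x
    with split-at x≤M (ℕ.≤-<-trans z≤n i<x) | split-at y≤M (subst (0 <_) x≡y (ℕ.≤-<-trans z≤n i<x))
  ...   | lastMaxSplit {w} {z} split | lastMaxSplit {w′} {z′} split′ =
    subst₂ _<ᵛ_ (sym (insAfter-++ M i l w z i≤w)) (sym (insAfter-++ M i l w′ z′ i≤w′))
      (<ᵛ-mapˡ (insAfter M i l) split split′
        (lastMax-Insertion (insAfter-Insertion M i l w i≤w) l≤M split)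
        (lastMax-Insertion (insAfter-Insertion M i l w′ i≤w′) l≤M split′)
        (insAfter-<ᵛ-acc (rec (length-prefix< w M z)) l≤M (proj₁ split) (proj₁ split′) i≤w w≡w′) x<y)
    where
      w≡w′ : count M w ≡ count M w′
      w≡w′ = count-prefix-≡ split split′ x≡y
      i≤w : i ≤ count M w
      i≤w = ℕ.≤-pred (subst (i <_) (count-lastMax w (proj₂ split)) i<x)
      i≤w′ : i ≤ count M w′
      i≤w′ = subst (i ≤_) w≡w′ i≤w

  <ᵛ-∷-after-last : l ≤ᶠ M → LastMax M w z → LastMax M w′ z′ → w ++ M ∷ z <ᵛ w′ ++ M ∷ z′ →
                    w ++ M ∷ l ∷ z <ᵛ w′ ++ M ∷ l ∷ z′
  <ᵛ-∷-after-last {l} {M} {w} {z} {w′} {z′} l≤M split split′ x<y with ≤ᶠ⇒<ᶠ⊎≡ l≤M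
  ... | inj₁ l<M =
    <ᵛ-mapʳ (l ∷_) split split′ (lastMax-suffix-∷ split l<M) (lastMax-suffix-∷ split′ l<M) <ᵛ-∷ x<y
  ... | inj₂ refl = subst₂ _<ᵛ_ (++-assoc w [ l ] (l ∷ z)) (++-assoc w′ [ l ] (l ∷ z′))
    (<ᵛ-mapˡ (_++ [ l ]) split split′ (lastMax-prefix-∷ʳ split Fin.≤-refl) (lastMax-prefix-∷ʳ split′ Fin.≤-refl)
      <ᵛ-∷ʳ x<y)

  insBefore-<ᵛ-acc : Acc _<_ (length x) → l ≤ᶠ M → All (_≤ᶠ M) x → All (_≤ᶠ M) y →
                     i ≤ count M x → count M x ≡ count M y → x <ᵛ y → insBefore M i l x <ᵛ insBefore M i l y
  insBefore-<ᵛ-acc {i = zero} _ _ _ _ _ _ x<y = <ᵛ-∷ x<y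
  insBefore-<ᵛ-acc {x} {l} {M} {y} {suc i} (acc rec) l≤M x≤M y≤M i<x x≡y x<y
    with split-at x≤M (ℕ.≤-<-trans z≤n i<x) | split-at y≤M (subst (0 <_) x≡y (ℕ.≤-<-trans z≤n i<x))
  ... | lastMaxSplit {w} {z} split | lastMaxSplit {w′} {z′} split′
    with ℕ.m≤n⇒m<n∨m≡n (subst (suc i ≤_) (count-lastMax w (proj₂ split)) i<x)
  ...   | inj₂ refl = subst₂ _<ᵛ_ (sym (insBefore-last M l w z))
    (sym (trans (cong (λ k → insBefore M (suc k) l (w′ ++ M ∷ z′)) w≡w′) (insBefore-last M l w′ z′)))
    (<ᵛ-∷-after-last l≤M split split′ x<y)
    where
      w≡w′ : count M w ≡ count M w′
      w≡w′ = count-prefix-≡ split split′ x≡y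
  ...   | inj₁ i<w =
    subst₂ _<ᵛ_ (sym (insBefore-++ M (suc i) l w z i≤w)) (sym (insBefore-++ M (suc i) l w′ z′ i≤w′))
      (<ᵛ-mapˡ (insBefore M (suc i) l) split split′
        (lastMax-Insertion (insBefore-Insertion M (suc i) l w i≤w) l≤M split)
        (lastMax-Insertion (insBefore-Insertion M (suc i) l w′ i≤w′) l≤M split′)
        (insBefore-<ᵛ-acc (rec (length-prefix< w M z)) l≤M (proj₁ split) (proj₁ split′) i≤w w≡w′) x<y)
    where
      w≡w′ : count M w ≡ count M w′
      w≡w′ = count-prefix-≡ split split′ x≡y
      i≤w : suc i ≤ count M w
      i≤w = ℕ.≤-pred i<w
      i≤w′ : suc i ≤ count M w′
      i≤w′ = subst (suc i ≤_) w≡w′ i≤w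

  insAfter-<ᵛ : l ≤ᶠ M → All (_≤ᶠ M) x → All (_≤ᶠ M) y →
                i ≤ count M x → count M x ≡ count M y → x <ᵛ y → insAfter M i l x <ᵛ insAfter M i l y
  insAfter-<ᵛ = insAfter-<ᵛ-acc (<-wellFounded _)

  insBefore-<ᵛ : l ≤ᶠ M → All (_≤ᶠ M) x → All (_≤ᶠ M) y →
                 i ≤ count M x → count M x ≡ count M y → x <ᵛ y → insBefore M i l x <ᵛ insBefore M i l y
  insBefore-<ᵛ = insBefore-<ᵛ-acc (<-wellFounded _)

  count-∷-< : count M x < count M y → count M (l ∷ x) < count M (l ∷ y)
  count-∷-< {M} {l = l} lt with l ≟ M
  ... | yes _ = s≤s lt
  ... | no _ = lt

  largest-unique : All (_≤ᶠ L) x → L ∈ x → All (_≤ᶠ L′) x → L′ ∈ x → L ≡ L′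
  largest-unique x≤L L∈x x≤L′ L′∈x = Fin.≤-antisym (All.lookup x≤L′ L∈x) (All.lookup x≤L L′∈x)

  top<⇒count< : All (_≤ᶠ L) x → L <ᶠ L′ → L′ ∈ y → All (_≤ᶠ L′) x × count L′ x < count L′ y
  top<⇒count< x≤L L<L′ L′∈y =
    All-≤-trans (ℕ.<⇒≤ L<L′) x≤L ,
    subst (_< _) (sym (below⇒count≡0 (All-≤-<-trans L<L′ x≤L))) (count-∈ L′∈y)

  -- All the argument needs of an insertion operation: it inserts l, and it is monotone on
  -- strings with the same largest letter M occurring equally often.
  module _ (ins : Fin σ → ℕ → Fin σ → Str σ → Str σ)
           (ins-Insertion : ∀ L i l x → i ≤ count L x → Insertion l x (ins L i l x))
           (ins-<ᵛ : ∀ {l M i x y} → l ≤ᶠ M → All (_≤ᶠ M) x → All (_≤ᶠ M) y →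
                     i ≤ count M x → count M x ≡ count M y → x <ᵛ y → ins M i l x <ᵛ ins M i l y)
         where

    count<⇒ins<ᵛ : l ≤ᶠ M → All (_≤ᶠ M) x → All (_≤ᶠ M) y → i ≤ count L x → i ≤ count L′ y →
                   count M x < count M y → ins L i l x <ᵛ ins L′ i l y
    count<⇒ins<ᵛ {l} {M} {x} {y} {i} {L} {L′} l≤M x≤M y≤M i≤x i≤y x<y =
      count-<⇒<ᵛ (Insertion-All insx x≤M l≤M) (Insertion-All insy y≤M l≤M)
        (subst₂ _<_ (sym (Insertion-count insx)) (sym (Insertion-count insy))
          (count-∷-< {M = M} {x = x} {y = y} {l = l} x<y))
      where
        insx : Insertion l x (ins L i l x)
        insx = ins-Insertion L i l x i≤x
        insy : Insertion l y (ins L′ i l y)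
        insy = ins-Insertion L′ i l y i≤y

    ins-<ᵛ-bounded : l ≤ᶠ M → All (_≤ᶠ M) x → All (_≤ᶠ M) y → i ≤ count M x → i ≤ count M y →
                     x <ᵛ y → ins M i l x <ᵛ ins M i l y
    ins-<ᵛ-bounded {M = M} {x} {y} l≤M x≤M y≤M i≤x i≤y x<y with ℕ.<-cmp (count M x) (count M y)
    ... | tri< x<y′ _ _ = count<⇒ins<ᵛ l≤M x≤M y≤M i≤x i≤y x<y′
    ... | tri≈ _ x≡y _ = ins-<ᵛ l≤M x≤M y≤M i≤x x≡y x<y
    ... | tri> _ _ y<x = ⊥-elim (<ᵛ-asym x<y (count-<⇒<ᵛ y≤M x≤M y<x))

    ins-<ᵛ-top : All (_≤ᶠ L) x → L ∈ x → All (_≤ᶠ L′) y → L′ ∈ y → l ≤ᶠ L ⊎ l ≤ᶠ L′ →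
                 i ≤ count L x → i ≤ count L′ y → x <ᵛ y → ins L i l x <ᵛ ins L′ i l y
    ins-<ᵛ-top {L} {L′ = L′} x≤L L∈x y≤L′ L′∈y l≤ i≤x i≤y x<y with Fin.<-cmp L L′
    ... | tri< L<L′ _ _ = let x≤L′ , x<y′ = top<⇒count< x≤L L<L′ L′∈y in
          count<⇒ins<ᵛ (≤-one-of l≤ (ℕ.<⇒≤ L<L′)) x≤L′ y≤L′ i≤x i≤y x<y′
    ... | tri≈ _ refl _ = ins-<ᵛ-bounded (≤-one-of l≤ Fin.≤-refl) x≤L y≤L′ i≤x i≤y x<y
    ... | tri> _ _ L′<L = let y≤L , y<x = top<⇒count< y≤L′ L′<L L∈x in
          ⊥-elim (<ᵛ-asym x<y (count-<⇒<ᵛ y≤L x≤L y<x))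

    ins-<ᵛ-⇔ : All (_≤ᶠ L) x → L ∈ x → All (_≤ᶠ L′) y → L′ ∈ y → l ≤ᶠ maxLetter L L′ →
               i ≤ count L x → i ≤ count L′ y → (ins L i l x <ᵛ ins L′ i l y) ⇔ (x <ᵛ y)
    ins-<ᵛ-⇔ {L} {L′ = L′} {l = l} x≤L L∈x y≤L′ L′∈y l≤ i≤x i≤y = mk⇔
      (preserves⇒reflects <ᵛ-cmp
        (λ { refl → cong (λ L → ins L _ _ _) (largest-unique x≤L L∈x y≤L′ L′∈y) })
        (ins-<ᵛ-top y≤L′ L′∈y x≤L L∈x (swap l≤′) i≤y i≤x))
      (ins-<ᵛ-top x≤L L∈x y≤L′ L′∈y l≤′ i≤x i≤y)
      where
        l≤′ : l ≤ᶠ L ⊎ l ≤ᶠ L′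
        l≤′ = ≤maxLetter L L′ l≤

lemma5 : ∀ {σ : ℕ} (a : Fin σ) (as : List (Fin σ)) (b : Fin σ) (bs : List (Fin σ))
           (l : Fin σ) (i : ℕ) →
           l ≤ᶠ maxLetter (𝓛 a as) (𝓛 b bs) →
           i ≤ 𝓒 a as → i ≤ 𝓒 b bs →
           ((insAfter (𝓛 a as) i l (a ∷ as) ≺ insAfter (𝓛 b bs) i l (b ∷ bs))
             ⇔ ((a ∷ as) ≺ (b ∷ bs)))
           × (((a ∷ as) ≺ (b ∷ bs))
             ⇔ (insBefore (𝓛 a as) i l (a ∷ as) ≺ insBefore (𝓛 b bs) i l (b ∷ bs)))
lemma5 a as b bs l i l≤ i≤x i≤y =
  via-<ᵛ (ins-<ᵛ-⇔ insAfter insAfter-Insertion insAfter-<ᵛ x≤ x∋ y≤ y∋ l≤ i≤x i≤y) ,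
  ⇔-sym (via-<ᵛ (ins-<ᵛ-⇔ insBefore insBefore-Insertion insBefore-<ᵛ x≤ x∋ y≤ y∋ l≤ i≤x i≤y))
  where
    x≤ : All (_≤ᶠ 𝓛 a as) (a ∷ as)
    x≤ = 𝓛-All a as
    y≤ : All (_≤ᶠ 𝓛 b bs) (b ∷ bs)
    y≤ = 𝓛-All b bs
    x∋ : 𝓛 a as ∈ a ∷ as
    x∋ = 𝓛-∈ a as
    y∋ : 𝓛 b bs ∈ b ∷ bs
    y∋ = 𝓛-∈ b bs
    via-<ᵛ : ∀ {σ} {x y x′ y′ : Str σ} → (x′ <ᵛ y′) ⇔ (x <ᵛ y) → (x′ ≺ y′) ⇔ (x ≺ y)
    via-<ᵛ e = ⇔-sym ≺⇔<ᵛ ⇔-∘ (e ⇔-∘ ≺⇔<ᵛ)
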